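{- Let $G$ be a finite simple graph that is claw-free and minimal $k$-factor-critical. Let $e=uv\in E(G)$, and let $S_e\subseteq V(G)\setminus\{u,v\}$ be any set with $|S_e|\ge k$ such that the graph $G_e=G-e-S_e$ has exactly $|S_e|-k+2$ odd components and $u$ and $v$ lie in two distinct odd components of $G_e$. Then for every subset $X\subseteq S_e$ with $|X|=k$, every perfect matching of $G-X$ contains $e$. Moreover, if $|S_e|\ge k+1$, then every vertex of $S_e$ has a neighbor in some odd component of $G_e$ other than the odd components containing $u$ and $v$.
   Context: A graph $G$ of order $n$ is $k$-factor-critical (for an integer $1\le k<n$) if for every set $X$ of $k$ vertices, $G-X$ has a perfect matching. A $k$-factor-critical graph is minimal if deleting any edge yields a graph that is not $k$-factor-critical. A graph is claw-free if it has no induced $K_{1,3}$. An odd (even) component is a connected component with an odd (even) number of vertices. (It is known that such a set $S_e$ exists for every edge $e$ of a minimal $k$-factor-critical graph.) -}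

module Defs where

open import Data.Nat using (ℕ; zero; suc; _%_; _≤_; _<_; _+_; _∸_)
open import Data.Bool using (Bool; true; false; _∧_; _∨_; not)
open import Data.Fin using (Fin; _≟_)
open import Data.Fin.Subset using (Subset; _∈_; _∉_; ∁; _⊆_; ∣_∣)
open import Data.Product using (Σ; ∃; ∃-syntax; _×_; _,_)
open import Relation.Binary.PropositionalEquality using (_≡_; _≢_)
open import Relation.Nullary using (¬_)
open import Relation.Nullary.Decidable using (⌊_⌋)

Graph : ℕ → Set
Graph n = Fin n → Fin n → Bool

IsSimple : {n : ℕ} → Graph n → Set
IsSimple {n} G = (∀ (x y : Fin n) → G x y ≡ G y x) × (∀ (x : Fin n) → G x x ≡ false)

Odd : ℕ → Set
Odd m = m % 2 ≡ 1

deleteEdge : {n : ℕ} → Graph n → Fin n → Fin n → Graph n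
deleteEdge G u v x y =
  G x y ∧ not ((⌊ x ≟ u ⌋ ∧ ⌊ y ≟ v ⌋) ∨ (⌊ x ≟ v ⌋ ∧ ⌊ y ≟ u ⌋))

IsPerfectMatching : {n : ℕ} → Graph n → Subset n → Graph n → Set
IsPerfectMatching {n} G W M =
    (∀ (x y : Fin n) → M x y ≡ M y x)
  × (∀ (x y : Fin n) → M x y ≡ true → G x y ≡ true)
  × (∀ (x y : Fin n) → M x y ≡ true → x ∈ W × y ∈ W)
  × (∀ (x : Fin n) → x ∈ W → ∃[ y ] M x y ≡ true)
  × (∀ (x y z : Fin n) → M x y ≡ true → M x z ≡ true → y ≡ z)

HasPerfectMatching : {n : ℕ} → Graph n → Subset n → Set
HasPerfectMatching G W = ∃[ M ] IsPerfectMatching G W M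

KFactorCritical : {n : ℕ} → ℕ → Graph n → Set
KFactorCritical {n} k G =
  ∀ (X : Subset n) → ∣ X ∣ ≡ k → HasPerfectMatching G (∁ X)

MinimalKFactorCritical : {n : ℕ} → ℕ → Graph n → Set
MinimalKFactorCritical {n} k G =
  KFactorCritical k G
  × (∀ (x y : Fin n) → G x y ≡ true → ¬ KFactorCritical k (deleteEdge G x y))

ClawFree : {n : ℕ} → Graph n → Set
ClawFree {n} G =
  ¬ (Σ (Fin n) λ c → Σ (Fin n) λ a → Σ (Fin n) λ b → Σ (Fin n) λ d →
       (G c a ≡ true) × (G c b ≡ true) × (G c d ≡ true)
     × (a ≢ b) × (a ≢ d) × (b ≢ d)
     × (G a b ≡ false) × (G a d ≡ false) × (G b d ≡ false))

data Reach {n : ℕ} (G : Graph n) (W : Subset n) : Fin n → Fin n → Set where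
  here : ∀ {x} → x ∈ W → Reach G W x x
  step : ∀ {x y z} → x ∈ W → G x y ≡ true → Reach G W y z → Reach G W x z

IsComponent : {n : ℕ} → Graph n → Subset n → Subset n → Set
IsComponent {n} G W C =
    (∃[ x ] x ∈ C)
  × (C ⊆ W)
  × (∀ (x y : Fin n) → x ∈ C → y ∈ C → Reach G W x y)
  × (∀ (x y : Fin n) → x ∈ C → Reach G W x y → y ∈ C)

IsOddComponent : {n : ℕ} → Graph n → Subset n → Subset n → Set
IsOddComponent G W C = IsComponent G W C × Odd ∣ C ∣

NumOddComponents : {n : ℕ} → Graph n → Subset n → ℕ → Set
NumOddComponents {n} G W m =
  Σ (Fin m → Subset n) λ comps →
      (∀ i → IsOddComponent G W (comps i))
    × (∀ i j → comps i ≡ comps j → i ≡ j)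
    × (∀ C → IsOddComponent G W C → ∃[ i ] comps i ≡ C)

{-# OPTIONS --safe #-}
module Submission where

-- Fix X ⊆ S with |X| = k and a perfect matching M of G − X. An odd component of
-- G_e = G − e − S cannot be matched within itself, so unless it meets an M-edge
-- that is absent from G_e, one of its vertices is matched into S; these mates are
-- distinct and avoid X. If uv ∉ M this gives |S| − k + 2 distinct mates in S − X,
-- which has |S| − k elements. For the second claim take X ⊆ S − s: now uv ∈ M, so
-- the components of u and v are represented by v and u, and if the mate of s lay in
-- no third odd component, the others would need distinct mates in S − X − s.

open import Defs
open import Data.Nat using (ℕ; zero; suc; _≤_; _<_; _+_; _∸_; _%_; z≤n; s≤s)
open import Data.Nat.Properties
  using (1+n≢0; ≤-trans; ≤-reflexive; ≤-pred; n≤1+n; <⇒≱; +-comm; +-assoc; +-suc; +-monoʳ-≤; m∸n+n≡m; module ≤-Reasoning)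
open import Data.Bool using (true; false)
open import Data.Bool.Properties using (¬-not) renaming (_≟_ to _≟ᵇ_)
open import Data.Fin using (Fin; zero; suc; _≟_)
open import Data.Fin.Properties using (any?; 0≢1+n; suc-injective)
open import Data.Fin.Subset using (Subset; inside; outside; _∈_; _∉_; ∁; _⊆_; _⊂_; ⊥; ⁅_⁆; _∪_; _-_; ∣_∣)
open import Data.Fin.Subset.Properties
  using ( _∈?_; nonempty?; Empty-unique; ∣⊥∣≡0; ⊥⊆; s⊆s; ⊆-antisym; ⊂-trans
        ; p⊆q⇒∣p∣≤∣q∣; p⊆q⇒∁p⊇∁q; x∈∁p⇒x∉p; x∉∁p⇒x∈p; x∉p⇒x∈∁p
        ; x∈⁅x⁆; ∣⁅x⁆∣≡1; x∈p∪q⁺; p─⊥≡p; p─q⊆p; x∈p∧x≢y⇒x∈p-y; x∈p⇒p-x⊂p; x∈p⇒∣p-x∣<∣p∣)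
open import Data.Fin.Subset.Induction using (Acc; acc; ⊂-wellFounded)
open import Data.Product using (Σ; ∃-syntax; _×_; _,_; proj₁; proj₂)
open import Data.Sum using (inj₁; inj₂)
open import Data.Empty using (⊥-elim)
open import Data.Vec.Base using ([]; _∷_; here; there)
open import Function.Definitions using (Injective)
open import Relation.Binary.PropositionalEquality
  using (_≡_; _≢_; refl; sym; trans; cong; cong₂; subst; module ≡-Reasoning)
open import Relation.Nullary using (¬_; yes; no)
open import Relation.Nullary.Decidable using (isYes≗does; dec-false; _×-dec_; ¬?)

private
  variable
    n m : ℕ

x∉p-x : ∀ (p : Subset n) x → x ∉ p - x
x∉p-x (_ ∷ p) zero ()
x∉p-x (_ ∷ p) (suc x) (there x∈p-x) = x∉p-x p x x∈p-x

∣p∣≡1+∣p-x∣ : ∀ {p : Subset n} {x} → x ∈ p → ∣ p ∣ ≡ suc ∣ p - x ∣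
∣p∣≡1+∣p-x∣ {p = inside ∷ p} here = cong suc (cong ∣_∣ (sym (p─⊥≡p p)))
∣p∣≡1+∣p-x∣ {p = inside ∷ p} (there x∈p) = cong suc (∣p∣≡1+∣p-x∣ x∈p)
∣p∣≡1+∣p-x∣ {p = outside ∷ p} (there x∈p) = ∣p∣≡1+∣p-x∣ x∈p

∣p∪q∣≤∣p∣+∣q∣ : ∀ (p q : Subset n) → ∣ p ∪ q ∣ ≤ ∣ p ∣ + ∣ q ∣
∣p∪q∣≤∣p∣+∣q∣ [] [] = z≤n
∣p∪q∣≤∣p∣+∣q∣ (outside ∷ p) (outside ∷ q) = ∣p∪q∣≤∣p∣+∣q∣ p q
∣p∪q∣≤∣p∣+∣q∣ (outside ∷ p) (inside ∷ q) =
  subst (suc ∣ p ∪ q ∣ ≤_) (sym (+-suc ∣ p ∣ ∣ q ∣)) (s≤s (∣p∪q∣≤∣p∣+∣q∣ p q))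
∣p∪q∣≤∣p∣+∣q∣ (inside ∷ p) (outside ∷ q) = s≤s (∣p∪q∣≤∣p∣+∣q∣ p q)
∣p∪q∣≤∣p∣+∣q∣ (inside ∷ p) (inside ∷ q) =
  s≤s (≤-trans (∣p∪q∣≤∣p∣+∣q∣ p q) (+-monoʳ-≤ ∣ p ∣ (n≤1+n ∣ q ∣)))

⊆-of-size : ∀ k (p : Subset n) → k ≤ ∣ p ∣ → ∃[ q ] q ⊆ p × ∣ q ∣ ≡ k
⊆-of-size {n} zero p _ = ⊥ , ⊥⊆ , ∣⊥∣≡0 n
⊆-of-size (suc k) (inside ∷ p) (s≤s k≤∣p∣) with ⊆-of-size k p k≤∣p∣
... | q , q⊆p , ∣q∣≡k = inside ∷ q , s⊆s q⊆p , cong suc ∣q∣≡k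
⊆-of-size (suc k) (outside ∷ p) k<∣p∣ with ⊆-of-size (suc k) p k<∣p∣
... | q , q⊆p , ∣q∣≡k = outside ∷ q , s⊆s q⊆p , ∣q∣≡k

injective⇒m+∣q∣≤∣p∣ : ∀ {f : Fin m → Fin n} {p q : Subset n} → Injective _≡_ _≡_ f
  → (∀ i → f i ∈ p) → (∀ i → f i ∉ q) → q ⊆ p → m + ∣ q ∣ ≤ ∣ p ∣
injective⇒m+∣q∣≤∣p∣ {zero} _ _ _ q⊆p = p⊆q⇒∣p∣≤∣q∣ q⊆p
injective⇒m+∣q∣≤∣p∣ {suc m} {f = f} {p} {q} f-inj f∈p f∉q q⊆p =
  ≤-trans (s≤s (injective⇒m+∣q∣≤∣p∣ {f = λ i → f (suc i)} {p - f zero}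
                 (λ e → suc-injective (f-inj e)) f∈p-f₀ (λ i → f∉q (suc i)) q⊆p-f₀))
          (x∈p⇒∣p-x∣<∣p∣ (f∈p zero))
  where
  f∈p-f₀ : ∀ i → f (suc i) ∈ p - f zero
  f∈p-f₀ i = x∈p∧x≢y⇒x∈p-y (f∈p (suc i)) (λ e → 0≢1+n (sym (f-inj e)))
  q⊆p-f₀ : q ⊆ p - f zero
  q⊆p-f₀ y∈q = x∈p∧x≢y⇒x∈p-y (q⊆p y∈q) (λ { refl → f∉q zero y∈q })

record IsFixedPointFreeInvolutionOn (σ : Fin n → Fin n) (C : Subset n) : Set where
  field
    closed : ∀ {x} → x ∈ C → σ x ∈ C
    involutive : ∀ {x} → x ∈ C → σ (σ x) ≡ x
    fixedPointFree : ∀ {x} → x ∈ C → σ x ≢ x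

module _ {σ : Fin n → Fin n} where

  private
    restrict : ∀ {C x} → IsFixedPointFreeInvolutionOn σ C → x ∈ C
      → IsFixedPointFreeInvolutionOn σ (C - x - σ x)
    restrict {C} {x} inv x∈C = record
      { closed = λ y∈ → let y∈C , y≢x , y≢σx = unpack y∈ in
          x∈p∧x≢y⇒x∈p-y (x∈p∧x≢y⇒x∈p-y (closed y∈C)
            (λ σy≡x → y≢σx (trans (sym (involutive y∈C)) (cong σ σy≡x))))
            (λ σy≡σx → y≢x (trans (sym (involutive y∈C)) (trans (cong σ σy≡σx) (involutive x∈C))))
      ; involutive = λ y∈ → involutive (proj₁ (unpack y∈))
      ; fixedPointFree = λ y∈ → fixedPointFree (proj₁ (unpack y∈))
      }
      where
      open IsFixedPointFreeInvolutionOn inv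
      unpack : ∀ {y} → y ∈ C - x - σ x → y ∈ C × y ≢ x × y ≢ σ x
      unpack {y} y∈ =
        p─q⊆p C ⁅ x ⁆ y∈C-x ,
        (λ { refl → x∉p-x C y y∈C-x }) ,
        (λ { refl → x∉p-x (C - x) y y∈ })
        where
        y∈C-x : y ∈ C - x
        y∈C-x = p─q⊆p (C - x) ⁅ σ x ⁆ y∈

    even : ∀ {C} → IsFixedPointFreeInvolutionOn σ C → Acc _⊂_ C → ∣ C ∣ % 2 ≡ 0
    even {C} inv (acc smaller) with nonempty? C
    ... | no empty = cong (_% 2) (trans (cong ∣_∣ (Empty-unique empty)) (∣⊥∣≡0 n))
    ... | yes (x , x∈C) = begin
      ∣ C ∣ % 2             ≡⟨ cong (_% 2) (trans (∣p∣≡1+∣p-x∣ x∈C) (cong suc (∣p∣≡1+∣p-x∣ σx∈C-x))) ⟩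
      suc (suc ∣ C' ∣) % 2  ≡⟨⟩
      ∣ C' ∣ % 2            ≡⟨ even (restrict inv x∈C) (smaller C'⊂C) ⟩
      0                     ∎
      where
      open ≡-Reasoning
      open IsFixedPointFreeInvolutionOn inv
      C' : Subset n
      C' = C - x - σ x
      σx∈C-x : σ x ∈ C - x
      σx∈C-x = x∈p∧x≢y⇒x∈p-y (closed x∈C) (fixedPointFree x∈C)
      C'⊂C : C' ⊂ C
      C'⊂C = ⊂-trans (x∈p⇒p-x⊂p σx∈C-x) (x∈p⇒p-x⊂p x∈C)

  fixedPointFreeInvolution⇒even : ∀ {C} → IsFixedPointFreeInvolutionOn σ C → ∣ C ∣ % 2 ≡ 0
  fixedPointFreeInvolution⇒even inv = even inv (⊂-wellFounded _)

deleteEdge-preserves : ∀ {G : Graph n} {u v x y} → G x y ≡ true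
  → ¬ (x ≡ u × y ≡ v) × ¬ (x ≡ v × y ≡ u) → deleteEdge G u v x y ≡ true
deleteEdge-preserves {u = u} {v} {x} {y} Gxy (¬uv , ¬vu)
  rewrite Gxy | isYes≗does (x ≟ u) | isYes≗does (y ≟ v) | isYes≗does (x ≟ v) | isYes≗does (y ≟ u)
        | dec-false (x ≟ u ×-dec y ≟ v) ¬uv | dec-false (x ≟ v ×-dec y ≟ u) ¬vu = refl

component-absorbs : ∀ {H : Graph n} {V C D x} → IsComponent H V C → IsComponent H V D
  → x ∈ C → x ∈ D → C ⊆ D
component-absorbs (_ , _ , connected , _) (_ , _ , _ , closed) x∈C x∈D y∈C =
  closed _ _ x∈D (connected _ _ x∈C y∈C)

module PerfectMatching {G : Graph n} {W : Subset n} {M : Graph n}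
  (loopless : ∀ x → G x x ≡ false) (pm : IsPerfectMatching G W M) where

  M-symmetric : ∀ x y → M x y ≡ M y x
  M-symmetric = proj₁ pm

  private
    M⊆G : ∀ x y → M x y ≡ true → G x y ≡ true
    M⊆G = proj₁ (proj₂ pm)
    M-within : ∀ x y → M x y ≡ true → x ∈ W × y ∈ W
    M-within = proj₁ (proj₂ (proj₂ pm))
    M-covers : ∀ x → x ∈ W → ∃[ y ] M x y ≡ true
    M-covers = proj₁ (proj₂ (proj₂ (proj₂ pm)))
    M-functional : ∀ x y z → M x y ≡ true → M x z ≡ true → y ≡ z
    M-functional = proj₂ (proj₂ (proj₂ (proj₂ pm)))

  -- Outside W there is no partner and mate x is junk (x itself).
  mate : Fin n → Fin n
  mate x with any? (λ y → M x y ≟ᵇ true)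
  ... | yes (y , _) = y
  ... | no _ = x

  mate-matched : ∀ {x} → x ∈ W → M x (mate x) ≡ true
  mate-matched {x} x∈W with any? (λ y → M x y ≟ᵇ true)
  ... | yes (_ , Mxy) = Mxy
  ... | no unmatched = ⊥-elim (unmatched (M-covers x x∈W))

  matched⇒mate≡ : ∀ {x y} → M x y ≡ true → mate x ≡ y
  matched⇒mate≡ {x} {y} Mxy =
    M-functional x (mate x) y (mate-matched (proj₁ (M-within x y Mxy))) Mxy

  mate∈W : ∀ {x} → x ∈ W → mate x ∈ W
  mate∈W {x} x∈W = proj₂ (M-within x (mate x) (mate-matched x∈W))

  mate-involutive : ∀ {x} → x ∈ W → mate (mate x) ≡ x
  mate-involutive {x} x∈W = matched⇒mate≡ (trans (M-symmetric (mate x) x) (mate-matched x∈W))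

  mate-adjacent : ∀ {x} → x ∈ W → G x (mate x) ≡ true
  mate-adjacent {x} x∈W = M⊆G x (mate x) (mate-matched x∈W)

  mate≢id : ∀ {x} → x ∈ W → mate x ≢ x
  mate≢id {x} x∈W mx≡x
    with () ← trans (sym (subst (λ y → G x y ≡ true) mx≡x (mate-adjacent x∈W))) (loopless x)

  unmatched⇒¬mates : ∀ {x a b} → M a b ≡ false → x ∈ W
    → ¬ (x ≡ a × mate x ≡ b) × ¬ (x ≡ b × mate x ≡ a)
  unmatched⇒¬mates {x} {a} {b} Mab≡false x∈W =
    notMates Mab≡false , notMates (trans (M-symmetric b a) Mab≡false)
    where
    notMates : ∀ {a b} → M a b ≡ false → ¬ (x ≡ a × mate x ≡ b)
    notMates Mab≡false (refl , refl) with () ← trans (sym (mate-matched x∈W)) Mab≡false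

  oddComponent-hasExit : ∀ {H : Graph n} {V C : Subset n} → IsOddComponent H V C → C ⊆ W
    → (∀ {x} → x ∈ C → mate x ∈ V → H x (mate x) ≡ true)
    → ∃[ x ] x ∈ C × mate x ∉ V
  oddComponent-hasExit {H} {V} {C} ((_ , C⊆V , _ , C-closed) , odd) C⊆W matchedInside
    with any? (λ x → x ∈? C ×-dec ¬? (mate x ∈? V))
  ... | yes exit = exit
  ... | no noExit = ⊥-elim (1+n≢0 (trans (sym odd) (fixedPointFreeInvolution⇒even record
          { closed = staysIn
          ; involutive = λ x∈C → mate-involutive (C⊆W x∈C)
          ; fixedPointFree = λ x∈C → mate≢id (C⊆W x∈C)
          })))
    where
    staysIn : ∀ {x} → x ∈ C → mate x ∈ C
    staysIn {x} x∈C with mate x ∈? V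
    ... | yes mx∈V = C-closed x (mate x) x∈C (step (C⊆V x∈C) (matchedInside x∈C mx∈V) (here mx∈V))
    ... | no mx∉V = ⊥-elim (noExit (x , x∈C , mx∉V))

module ComponentList {H : Graph n} {V : Subset n} (comps : Fin m → Subset n)
  (isComponent : ∀ i → IsComponent H V (comps i))
  (distinct : ∀ i j → comps i ≡ comps j → i ≡ j) where

  sharedVertex⇒≡ : ∀ {i j x} → x ∈ comps i → x ∈ comps j → i ≡ j
  sharedVertex⇒≡ {i} {j} x∈i x∈j = distinct i j (⊆-antisym
    (component-absorbs (isComponent i) (isComponent j) x∈i x∈j)
    (component-absorbs (isComponent j) (isComponent i) x∈j x∈i))

  representatives⇒m+∣Y∣≤∣T∣ : ∀ {T Y : Subset n} (g : Fin n → Fin n) → Y ⊆ T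
    → (∀ i → ∃[ y ] y ∈ T × y ∉ Y × g y ∈ comps i) → m + ∣ Y ∣ ≤ ∣ T ∣
  representatives⇒m+∣Y∣≤∣T∣ g Y⊆T rep =
    injective⇒m+∣q∣≤∣p∣ {f = r} r-injective (λ i → proj₁ (proj₂ (rep i)))
      (λ i → proj₁ (proj₂ (proj₂ (rep i)))) Y⊆T
    where
    r : Fin m → Fin n
    r i = proj₁ (rep i)
    r-injective : Injective _≡_ _≡_ r
    r-injective {i} {j} ri≡rj = sharedVertex⇒≡ (proj₂ (proj₂ (proj₂ (rep i))))
      (subst (λ y → g y ∈ comps j) (sym ri≡rj) (proj₂ (proj₂ (proj₂ (rep j)))))

module _ {G : Graph n} (loopless : ∀ x → G x x ≡ false) {u v : Fin n} {S : Subset n}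
  (comps : Fin m → Subset n) (odd : ∀ i → IsOddComponent (deleteEdge G u v) (∁ S) (comps i))
  (distinct : ∀ i j → comps i ≡ comps j → i ≡ j)
  {X : Subset n} (X⊆S : X ⊆ S) {M : Graph n} (pm : IsPerfectMatching G (∁ X) M) where

  open PerfectMatching loopless pm
  open ComponentList comps (λ i → proj₁ (odd i)) distinct

  private
    comps⊆∁X : ∀ i → comps i ⊆ ∁ X
    comps⊆∁X i x∈ = p⊆q⇒∁p⊇∁q X⊆S (proj₁ (proj₂ (proj₁ (odd i))) x∈)

    exit : ∀ i → (∀ {x} → x ∈ comps i → deleteEdge G u v x (mate x) ≡ true)
      → ∃[ x ] x ∈ comps i × mate x ∈ S
    exit i matchedInside with oddComponent-hasExit (odd i) (comps⊆∁X i) (λ x∈ _ → matchedInside x∈)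
    ... | x , x∈ , mx∉∁S = x , x∈ , x∉∁p⇒x∈p mx∉∁S

    mate∉X : ∀ {x} → x ∉ X → mate x ∉ X
    mate∉X x∉X = x∈∁p⇒x∉p (mate∈W (x∉p⇒x∈∁p x∉X))

    mate-inverse∈ : ∀ {i x} → x ∈ comps i → mate (mate x) ∈ comps i
    mate-inverse∈ {i} x∈ = subst (_∈ comps i) (sym (mate-involutive (comps⊆∁X i x∈))) x∈

  matching-contains-uv : ∣ S ∣ < m + ∣ X ∣ → M u v ≡ true
  matching-contains-uv tooMany = ¬-not λ Muv≡false →
    <⇒≱ tooMany (representatives⇒m+∣Y∣≤∣T∣ mate X⊆S (representative Muv≡false))
    where
    representative : M u v ≡ false → ∀ i → ∃[ y ] y ∈ S × y ∉ X × mate y ∈ comps i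
    representative Muv≡false i with exit i (λ x∈ → let x∈∁X = comps⊆∁X i x∈ in
        deleteEdge-preserves {G = G} (mate-adjacent x∈∁X) (unmatched⇒¬mates Muv≡false x∈∁X))
    ... | x , x∈ , mx∈S = mate x , mx∈S , mate∉X (x∈∁p⇒x∉p (comps⊆∁X i x∈)) , mate-inverse∈ x∈

  neighbour-outside-uv-components : u ∉ S → v ∉ S → M u v ≡ true → suc ∣ S ∣ < m + ∣ X ∣
    → ∀ {s} → s ∈ S → s ∉ X
    → ∃[ i ] u ∉ comps i × v ∉ comps i × ∃[ w ] w ∈ comps i × G s w ≡ true
  neighbour-outside-uv-components u∉S v∉S Muv tooMany {s} s∈S s∉X
    with any? (λ i → mate s ∈? comps i ×-dec ¬? (u ∈? comps i) ×-dec ¬? (v ∈? comps i))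
  ... | yes (i , ms∈ , u∉ , v∉) = i , u∉ , v∉ , mate s , ms∈ , mate-adjacent (x∉p⇒x∈∁p s∉X)
  ... | no none = ⊥-elim (<⇒≱ tooMany (begin
      m + ∣ X ∣                            ≤⟨ representatives⇒m+∣Y∣≤∣T∣ mate X⊆T representative ⟩
      ∣ T ∣                                ≤⟨ ∣p∪q∣≤∣p∣+∣q∣ (S - s) (⁅ u ⁆ ∪ ⁅ v ⁆) ⟩
      ∣ S - s ∣ + ∣ ⁅ u ⁆ ∪ ⁅ v ⁆ ∣          ≤⟨ +-monoʳ-≤ ∣ S - s ∣ (∣p∪q∣≤∣p∣+∣q∣ ⁅ u ⁆ ⁅ v ⁆) ⟩
      ∣ S - s ∣ + (∣ ⁅ u ⁆ ∣ + ∣ ⁅ v ⁆ ∣)  ≡⟨ cong₂ (λ a b → ∣ S - s ∣ + (a + b)) (∣⁅x⁆∣≡1 u) (∣⁅x⁆∣≡1 v) ⟩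
      ∣ S - s ∣ + 2                        ≡⟨ +-comm ∣ S - s ∣ 2 ⟩
      suc (suc ∣ S - s ∣)                  ≡⟨ cong suc (sym (∣p∣≡1+∣p-x∣ s∈S)) ⟩
      suc ∣ S ∣                            ∎))
    where
    open ≤-Reasoning
    T : Subset n
    T = (S - s) ∪ ⁅ u ⁆ ∪ ⁅ v ⁆
    X⊆T : X ⊆ T
    X⊆T x∈X = x∈p∪q⁺ (inj₁ (x∈p∧x≢y⇒x∈p-y (X⊆S x∈X) (λ { refl → s∉X x∈X })))
    u∈T : u ∈ T
    u∈T = x∈p∪q⁺ (inj₂ (x∈p∪q⁺ (inj₁ (x∈⁅x⁆ u))))
    v∈T : v ∈ T
    v∈T = x∈p∪q⁺ (inj₂ (x∈p∪q⁺ (inj₂ (x∈⁅x⁆ v))))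
    mate-u≡v : mate u ≡ v
    mate-u≡v = matched⇒mate≡ Muv
    mate-v≡u : mate v ≡ u
    mate-v≡u = matched⇒mate≡ (trans (M-symmetric v u) Muv)
    representative : ∀ i → ∃[ y ] y ∈ T × y ∉ X × mate y ∈ comps i
    representative i with u ∈? comps i | v ∈? comps i
    ... | yes u∈ | _ = v , v∈T , (λ v∈X → v∉S (X⊆S v∈X)) , subst (_∈ comps i) (sym mate-v≡u) u∈
    ... | no _ | yes v∈ = u , u∈T , (λ u∈X → u∉S (X⊆S u∈X)) , subst (_∈ comps i) (sym mate-u≡v) v∈
    ... | no u∉ | no v∉ with exit i (λ x∈ → deleteEdge-preserves {G = G} (mate-adjacent (comps⊆∁X i x∈))
                                (( λ (x≡u , _) → u∉ (subst (_∈ comps i) x≡u x∈))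
                                , (λ (x≡v , _) → v∉ (subst (_∈ comps i) x≡v x∈))))
    ...   | x , x∈ , mx∈S = mate x , x∈p∪q⁺ (inj₁ (x∈p∧x≢y⇒x∈p-y mx∈S mx≢s))
                          , mate∉X (x∈∁p⇒x∉p (comps⊆∁X i x∈)) , mate-inverse∈ x∈
      where
      mx≢s : mate x ≢ s
      mx≢s mx≡s = none (i , subst (λ y → mate y ∈ comps i) mx≡s (mate-inverse∈ x∈) , u∉ , v∉)

m∸n+2+n≡2+m : ∀ {m n} → n ≤ m → m ∸ n + 2 + n ≡ 2 + m
m∸n+2+n≡2+m {m} {n} n≤m = begin
  m ∸ n + 2 + n    ≡⟨ +-assoc (m ∸ n) 2 n ⟩
  m ∸ n + (2 + n)  ≡⟨ cong (m ∸ n +_) (+-comm 2 n) ⟩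
  m ∸ n + (n + 2)  ≡⟨ sym (+-assoc (m ∸ n) n 2) ⟩
  m ∸ n + n + 2    ≡⟨ cong (_+ 2) (m∸n+n≡m n≤m) ⟩
  m + 2            ≡⟨ +-comm m 2 ⟩
  2 + m            ∎
  where open ≡-Reasoning

lemma3p1 : (n k : ℕ) (G : Graph n) → IsSimple G → 1 ≤ k → k < n
    → ClawFree G → MinimalKFactorCritical k G
    → (u v : Fin n) → G u v ≡ true
    → (S : Subset n) → u ∉ S → v ∉ S → k ≤ ∣ S ∣
    → NumOddComponents (deleteEdge G u v) (∁ S) (∣ S ∣ ∸ k + 2)
    → (Σ (Subset n) λ Cu → Σ (Subset n) λ Cv →
         IsOddComponent (deleteEdge G u v) (∁ S) Cu
         × IsOddComponent (deleteEdge G u v) (∁ S) Cv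
         × u ∈ Cu × v ∈ Cv × Cu ≢ Cv)
    → ((X : Subset n) → X ⊆ S → ∣ X ∣ ≡ k
         → (M : Graph n) → IsPerfectMatching G (∁ X) M → M u v ≡ true)
      × (suc k ≤ ∣ S ∣ → (s : Fin n) → s ∈ S
         → Σ (Subset n) λ C →
             IsOddComponent (deleteEdge G u v) (∁ S) C
             × u ∉ C × v ∉ C × (∃[ w ] (w ∈ C × G s w ≡ true)))
lemma3p1 n k G (_ , loopless) _ _ _ (factorCritical , _) u v _ S u∉S v∉S k≤∣S∣
  (comps , odd , distinct , _) _ = contains-uv , neighbour
  where
  tooMany : ∀ {X : Subset n} → ∣ X ∣ ≡ k → suc ∣ S ∣ < ∣ S ∣ ∸ k + 2 + ∣ X ∣
  tooMany ∣X∣≡k = ≤-reflexive (sym (trans (cong (∣ S ∣ ∸ k + 2 +_) ∣X∣≡k) (m∸n+2+n≡2+m k≤∣S∣)))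

  contains-uv : (X : Subset n) → X ⊆ S → ∣ X ∣ ≡ k
    → (M : Graph n) → IsPerfectMatching G (∁ X) M → M u v ≡ true
  contains-uv X X⊆S ∣X∣≡k M pm =
    matching-contains-uv loopless comps odd distinct X⊆S pm (≤-trans (n≤1+n _) (tooMany {X} ∣X∣≡k))

  neighbour : suc k ≤ ∣ S ∣ → (s : Fin n) → s ∈ S
    → Σ (Subset n) λ C → IsOddComponent (deleteEdge G u v) (∁ S) C
        × u ∉ C × v ∉ C × (∃[ w ] (w ∈ C × G s w ≡ true))
  neighbour k<∣S∣ s s∈S
    with ⊆-of-size k (S - s) (≤-pred (subst (suc k ≤_) (∣p∣≡1+∣p-x∣ s∈S) k<∣S∣))
  ... | X , X⊆S-s , ∣X∣≡k
    with factorCritical X ∣X∣≡k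
  ...   | M , pm
    with neighbour-outside-uv-components loopless comps odd distinct X⊆S pm u∉S v∉S
           (contains-uv X X⊆S ∣X∣≡k M pm) (tooMany {X} ∣X∣≡k) s∈S (λ s∈X → x∉p-x S s (X⊆S-s s∈X))
    where
    X⊆S : X ⊆ S
    X⊆S x∈X = p─q⊆p S ⁅ s ⁆ (X⊆S-s x∈X)
  ...     | i , u∉ , v∉ , w = comps i , odd i , u∉ , v∉ , w
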